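{- For every $n\geq 2$, the map $\psi$ (defined in the context) restricts to a bijection from $\mathcal{A}_n$ onto $\mathcal{M}_{n-1}$.
   Context: A Dyck path with air pockets is a non-empty lattice path in the first quadrant of $\mathbb{Z}^2$ starting at the origin, ending on the $x$-axis, consisting of up-steps $U=(1,1)$ and down-steps $D_k=(1,-k)$, $k\geq 1$, such that no two down-steps are consecutive. We write $D=D_1$. The length is the number of steps; $\mathcal{A}_n$ is the set of such paths of length $n$ and $\mathcal{A}=\bigcup_{n\geq 2}\mathcal{A}_n$. A path in $\mathcal{A}$ is prime if its last step is $D_k$ with $k\geq 2$ and it touches the $x$-axis only at its start and its end; $\mathcal{P}$ denotes the set of prime paths. A prime path has the form $\alpha=U\beta UD_k$ ($k\geq 2$, $\beta$ a possibly empty word), and its lowering is $\alpha^\flat=\beta UD_{k-1}\in\mathcal{A}$; the map $\alpha\mapsto\alpha^\flat$ is a bijection from prime paths of length $n$ to $\mathcal{A}_{n-1}$. Every $\alpha\in\mathcal{A}$ is of exactly one of the forms: $UD$; $\beta UD$ with $\beta\in\mathcal{A}$; $\alpha\in\mathcal{P}$; $\beta\gamma$ with $\beta\in\mathcal{A}$, $\gamma\in\mathcal{P}$. A peakless Motzkin path of length $n$ is a lattice path from $(0,0)$ to $(n,0)$ staying weakly above the $x$-axis, with steps $U=(1,1)$, $D=(1,-1)$, $F=(1,0)$, having no factor $UD$; $\mathcal{M}_n$ is the set of these and $\mathcal{M}=\bigcup_{n\geq1}\mathcal{M}_n$. The map $\psi:\mathcal{A}\to\mathcal{M}$ is defined recursively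 by: $\psi(UD)=F$; $\psi(\beta UD)=U\psi(\beta)D$ for $\beta\in\mathcal{A}$; $\psi(\alpha)=\psi(\alpha^\flat)F$ for $\alpha\in\mathcal{P}$; $\psi(\beta\gamma)=\psi(\gamma^\flat)U\psi(\beta)D$ for $\beta\in\mathcal{A}$, $\gamma\in\mathcal{P}$. -}

module Defs where

open import Data.Nat using (ℕ; zero; suc; _+_; _∸_; _≤_)
open import Data.List using (List; []; _∷_; _++_; length)
open import Data.Product using (_×_; ∃; ∃-syntax)
open import Data.Empty using (⊥)
open import Data.Unit using (⊤)
open import Relation.Binary.PropositionalEquality using (_≡_; _≢_)
open import Relation.Nullary using (¬_)

-- Steps: U = (1,1), D k = (1,-k).  (Validity requires k ≥ 1.)
data AStep : Set where
  U : AStep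
  D : ℕ → AStep

-- AWalk h h' w : reading w from height h, the walk stays in the first
-- quadrant (heights are natural numbers), every down step D k has k ≥ 1,
-- and it ends at height h'.
data AWalk : ℕ → ℕ → List AStep → Set where
  []  : ∀ {h} → AWalk h h []
  U∷_ : ∀ {h h' w} → AWalk (suc h) h' w → AWalk h h' (U ∷ w)
  D∷_ : ∀ {k h h' w} → 1 ≤ k → AWalk h h' w → AWalk (k + h) h' (D k ∷ w)

NoDD : List AStep → Set
NoDD []                 = ⊤
NoDD (U ∷ w)            = NoDD w
NoDD (D _ ∷ [])         = ⊤
NoDD (D _ ∷ U ∷ w)      = NoDD (U ∷ w)
NoDD (D _ ∷ D _ ∷ _)    = ⊥

IsA : List AStep → Set
IsA α = AWalk 0 0 α × NoDD α × α ≢ []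

InA : ℕ → List AStep → Set
InA n α = IsA α × length α ≡ n

IsPrime : List AStep → Set
IsPrime α =
  IsA α
  × (∃[ β ] ∃[ k ] (α ≡ β ++ D k ∷ [] × 2 ≤ k))
  × (∀ p q → α ≡ p ++ q → p ≢ [] → q ≢ [] → ¬ AWalk 0 0 p)

lowerStep : AStep → AStep
lowerStep U     = U
lowerStep (D k) = D (k ∸ 1)

lowerLast : List AStep → List AStep
lowerLast []           = []
lowerLast (x ∷ [])     = lowerStep x ∷ []
lowerLast (x ∷ y ∷ w)  = x ∷ lowerLast (y ∷ w)

lower : List AStep → List AStep
lower []      = []
lower (U ∷ w) = lowerLast w
lower (D k ∷ w) = D k ∷ w   -- never used (prime paths start with U)

data MStep : Set where
  up : MStep
  dn : MStep
  fl : MStep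

data MWalk : ℕ → ℕ → List MStep → Set where
  []   : ∀ {h} → MWalk h h []
  up∷_ : ∀ {h h' w} → MWalk (suc h) h' w → MWalk h h' (up ∷ w)
  dn∷_ : ∀ {h h' w} → MWalk h h' w → MWalk (suc h) h' (dn ∷ w)
  fl∷_ : ∀ {h h' w} → MWalk h h' w → MWalk h h' (fl ∷ w)

NoPeak : List MStep → Set
NoPeak []            = ⊤
NoPeak (up ∷ dn ∷ _) = ⊥
NoPeak (_ ∷ w)       = NoPeak w

IsM : List MStep → Set
IsM μ = MWalk 0 0 μ × NoPeak μ × μ ≢ []

InM : ℕ → List MStep → Set
InM n μ = IsM μ × length μ ≡ n

-- The map ψ, given by its recursive defining clauses (as its graph):
-- Ψ α μ  means  ψ(α) = μ.

data Ψ : List AStep → List MStep → Set where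
  ψ-UD   : Ψ (U ∷ D 1 ∷ []) (fl ∷ [])
  ψ-βUD  : ∀ {β m} → IsA β → Ψ β m →
           Ψ (β ++ U ∷ D 1 ∷ []) (up ∷ m ++ dn ∷ [])
  ψ-P    : ∀ {α m} → IsPrime α → Ψ (lower α) m →
           Ψ α (m ++ fl ∷ [])
  ψ-βγ   : ∀ {β γ m m'} → IsA β → IsPrime γ → Ψ β m → Ψ (lower γ) m' →
           Ψ (β ++ γ) (m' ++ up ∷ m ++ dn ∷ [])

-- Every path in 𝒜 has exactly one of the forms UD, βUD, γ and βγ with γ prime: if the last step
-- is D the step before it is U, and if it is D_k with k ≥ 2 then γ is the last arch of the path,
-- the part after its last return to the axis. Likewise every path in ℳ is F, μF, UμD or μ'UμD,
-- split by its last step and, when that is D, by the matching up step. The four clauses of ψ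
-- carry the four forms of 𝒜 onto the four forms of ℳ, both decompositions are unique, and
-- lowering is a bijection from prime paths onto 𝒜 that removes one step. Well-founded induction
-- on length therefore makes ψ a well-defined bijection 𝒜ₙ → ℳₙ₋₁.

module Submission where

open import Defs
open import Data.Nat using (ℕ; zero; suc; _+_; _∸_; _≤_; _<_; z≤n; s≤s)
open import Data.Nat.Properties
  using (+-suc; +-comm; +-assoc; +-cancelˡ-≡; +-identityʳ; suc-injective; <-≤-trans; ≤-reflexive)
open import Data.List using (List; []; _∷_; _++_; _∷ʳ_; length)
open import Data.List.Properties
  using ( ++-assoc; ++-identityʳ; ++-cancelʳ; ++-conicalˡ; ∷-injective; ∷-injectiveʳ
        ; ∷ʳ-injective; ∷ʳ-injectiveˡ; length-++; length-++-≤ˡ; length-++-≤ʳ)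
open import Data.List.Reverse using (Reverse; []; _∶_∶ʳ_; reverseView)
open import Data.Product using (_×_; _,_; proj₁; proj₂; ∃-syntax)
open import Data.Sum using (_⊎_; inj₁; inj₂)
open import Data.Empty using (⊥; ⊥-elim)
open import Data.Unit using (tt)
open import Data.Nat.Induction using (<-wellFounded)
open import Data.Nat.Tactic.RingSolver using (solve-∀)
open import Induction.WellFounded using (WellFounded; Acc; acc)
import Relation.Binary.Construct.On as On
open import Relation.Binary.PropositionalEquality
open import Relation.Nullary using (¬_)

module _ {A : Set} where

  ++∷≢[] : ∀ (x : List A) {a y} → x ++ a ∷ y ≢ []
  ++∷≢[] [] ()
  ++∷≢[] (_ ∷ _) ()

  ++-split : ∀ (b c b' c' : List A) → b ++ c ≡ b' ++ c' →
    (∃[ d ] (b' ≡ b ++ d × c ≡ d ++ c')) ⊎ (∃[ d ] (b ≡ b' ++ d × c' ≡ d ++ c))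
  ++-split []      c b'       c' eq = inj₁ (b' , refl , eq)
  ++-split (x ∷ b) c []       c' eq = inj₂ (x ∷ b , refl , sym eq)
  ++-split (x ∷ b) c (y ∷ b') c' eq with refl , eq' ← ∷-injective eq with ++-split b c b' c' eq'
  ... | inj₁ (d , e , e') = inj₁ (d , cong (x ∷_) e , e')
  ... | inj₂ (d , e , e') = inj₂ (d , cong (x ∷_) e , e')

  ∷ʳ-prefix : ∀ (x p q : List A) {a} → x ∷ʳ a ≡ p ++ q → q ≢ [] → ∃[ r ] (x ≡ p ++ r)
  ∷ʳ-prefix x       []          q eq q≢[] = x , refl
  ∷ʳ-prefix []      (_ ∷ [])    q eq q≢[] = ⊥-elim (q≢[] (sym (∷-injectiveʳ eq)))
  ∷ʳ-prefix []      (_ ∷ _ ∷ _) q ()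
  ∷ʳ-prefix (b ∷ x) (_ ∷ p)     q eq q≢[] with refl , eq' ← ∷-injective eq =
    let r , e = ∷ʳ-prefix x p q eq' q≢[] in r , cong (b ∷_) e

  ∷ʳ-suffix : ∀ (x y z : List A) {a} → x ++ y ≡ z ∷ʳ a → y ≢ [] → ∃[ y' ] (y ≡ y' ∷ʳ a)
  ∷ʳ-suffix x y z eq y≢[] with reverseView y
  ... | [] = ⊥-elim (y≢[] refl)
  ... | y' ∶ _ ∶ʳ b with _ , refl ← ∷ʳ-injective (x ++ y') z (trans (++-assoc x y' _) eq) =
    y' , refl

  infix 4 _≺_
  _≺_ : List A → List A → Set
  xs ≺ ys = length xs < length ys

  ≺-wellFounded : WellFounded _≺_
  ≺-wellFounded = On.wellFounded length <-wellFounded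

  xs≺xs++ys : ∀ xs {ys} → ys ≢ [] → xs ≺ xs ++ ys
  xs≺xs++ys []       {[]}    ys≢[] = ⊥-elim (ys≢[] refl)
  xs≺xs++ys []       {_ ∷ _} _     = s≤s z≤n
  xs≺xs++ys (_ ∷ xs) ys≢[]         = s≤s (xs≺xs++ys xs ys≢[])

  xs≺x∷xs++ys : ∀ x xs ys → xs ≺ x ∷ xs ++ ys
  xs≺x∷xs++ys _ xs _ = s≤s (length-++-≤ˡ xs)

  xs≺ys⇒xs≺zs++ys : ∀ zs {xs ys} → xs ≺ ys → xs ≺ zs ++ ys
  xs≺ys⇒xs≺zs++ys zs {ys = ys} xs≺ys = <-≤-trans xs≺ys (length-++-≤ʳ ys {zs})

-- Walks with air pockets

AWalk-++ : ∀ {a b c x y} → AWalk a b x → AWalk b c y → AWalk a c (x ++ y)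
AWalk-++ []        w = w
AWalk-++ (U∷ v)    w = U∷ AWalk-++ v w
AWalk-++ (D∷_ k v) w = D∷_ k (AWalk-++ v w)

AWalk-split : ∀ {a c} x {y} → AWalk a c (x ++ y) → ∃[ b ] (AWalk a b x × AWalk b c y)
AWalk-split []        w           = _ , [] , w
AWalk-split (U ∷ x)   (U∷ w)      with b , v , v' ← AWalk-split x w = b , U∷ v , v'
AWalk-split (D k ∷ x) (D∷_ 1≤k w) with b , v , v' ← AWalk-split x w = b , D∷_ 1≤k v , v'

AWalk-displacement : ∀ {a b a' b' w} → AWalk a b w → AWalk a' b' w → a + b' ≡ a' + b
AWalk-displacement {a} {_} {a'} [] [] = +-comm a a'
AWalk-displacement (U∷ v) (U∷ v') = suc-injective (AWalk-displacement v v')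
AWalk-displacement {b = b} {b' = b'} (D∷_ {k} {h} _ v) (D∷_ {h = h'} _ v') = begin
  k + h + b'    ≡⟨ +-assoc k h b' ⟩
  k + (h + b')  ≡⟨ cong (k +_) (AWalk-displacement v v') ⟩
  k + (h' + b)  ≡⟨ +-assoc k h' b ⟨
  k + h' + b    ∎
  where open ≡-Reasoning

AWalk-end-unique : ∀ {a b b' w} → AWalk a b w → AWalk a b' w → b ≡ b'
AWalk-end-unique v v' = sym (+-cancelˡ-≡ _ _ _ (AWalk-displacement v v'))

AWalk-ground-suffix : ∀ β {d} → AWalk 0 0 β → AWalk 0 0 (β ++ d) → AWalk 0 0 d
AWalk-ground-suffix β wβ w with _ , wβ' , wd ← AWalk-split β w
  with refl ← AWalk-end-unique wβ wβ' = wd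

AWalk-lift : ∀ {a b w} → AWalk a b w → AWalk (suc a) (suc b) w
AWalk-lift []     = []
AWalk-lift (U∷ v) = U∷ AWalk-lift v
AWalk-lift {b = b} {w = D k ∷ w} (D∷_ {h = h} 1≤k v) =
  subst (λ a → AWalk a (suc b) (D k ∷ w)) (+-suc k h) (D∷_ 1≤k (AWalk-lift v))

¬lifted-reaches-ground : ∀ {a b} p {q} → AWalk a b (p ++ q) → ¬ AWalk (suc a) 0 p
¬lifted-reaches-ground {a} p w v with c , wp , _ ← AWalk-split p w
  with () ← +-cancelˡ-≡ (suc a) _ _ (AWalk-displacement v (AWalk-lift wp))

AWalk-D⁻ : ∀ {a b k w} → AWalk a b (D k ∷ w) → 1 ≤ k × ∃[ h ] (a ≡ k + h × AWalk h b w)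
AWalk-D⁻ (D∷_ 1≤k v) = 1≤k , _ , refl , v

AWalk-D-tail : ∀ {b k h w} → AWalk (k + h) b (D k ∷ w) → AWalk h b w
AWalk-D-tail {k = k} {h} v with _ , _ , eq , v' ← AWalk-D⁻ v =
  subst (λ a → AWalk a _ _) (sym (+-cancelˡ-≡ k h _ eq)) v'

AWalk-D-ground : ∀ {k} → 1 ≤ k → AWalk k 0 (D k ∷ [])
AWalk-D-ground {k} 1≤k = subst (λ h → AWalk h 0 (D k ∷ [])) (+-identityʳ k) (D∷_ 1≤k [])

¬AWalk-ground-D : ∀ {b k w} → ¬ AWalk 0 b (D k ∷ w)
¬AWalk-ground-D v with s≤s _ , _ , () , _ ← AWalk-D⁻ v

¬AWalk-∷ʳU-ground : ∀ {a} x → ¬ AWalk a 0 (x ∷ʳ U)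
¬AWalk-∷ʳU-ground x v with _ , _ , U∷ () ← AWalk-split x v

NoDD-tail : ∀ s w → NoDD (s ∷ w) → NoDD w
NoDD-tail U     w         n = n
NoDD-tail (D _) []        n = tt
NoDD-tail (D _) (U ∷ w)   n = n
NoDD-tail (D _) (D _ ∷ w) ()

NoDD-suffix : ∀ x {y} → NoDD (x ++ y) → NoDD y
NoDD-suffix []      n = n
NoDD-suffix (s ∷ x) n = NoDD-suffix x (NoDD-tail s (x ++ _) n)

NoDD-prefix : ∀ x {y} → NoDD (x ++ y) → NoDD x
NoDD-prefix []              n = tt
NoDD-prefix (U ∷ x)         n = NoDD-prefix x n
NoDD-prefix (D _ ∷ [])      n = tt
NoDD-prefix (D _ ∷ U ∷ x)   n = NoDD-prefix (U ∷ x) n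
NoDD-prefix (D _ ∷ D _ ∷ x) ()

NoDD-++U : ∀ x {y} → NoDD x → NoDD (U ∷ y) → NoDD (x ++ U ∷ y)
NoDD-++U []              n m = m
NoDD-++U (U ∷ x)         n m = NoDD-++U x n m
NoDD-++U (D _ ∷ [])      n m = m
NoDD-++U (D _ ∷ U ∷ x)   n m = NoDD-++U (U ∷ x) n m
NoDD-++U (D _ ∷ D _ ∷ x) ()

NoDD-∷ʳD : ∀ x {i j} → NoDD (x ∷ʳ D i) → NoDD (x ∷ʳ D j)
NoDD-∷ʳD []              n = tt
NoDD-∷ʳD (U ∷ x)         n = NoDD-∷ʳD x n
NoDD-∷ʳD (D _ ∷ [])      ()
NoDD-∷ʳD (D _ ∷ U ∷ x)   n = NoDD-∷ʳD (U ∷ x) n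
NoDD-∷ʳD (D _ ∷ D _ ∷ x) ()

Positive : ℕ → List AStep → Set
Positive h w = ∀ p q → w ≡ p ++ q → ¬ AWalk h 0 p

-- The truncated subtractions are harmless: positivity forces a ≥ 1 and b ≥ 1.
AWalk-unlift : ∀ {a b w} → AWalk a b w → Positive a w → AWalk (a ∸ 1) (b ∸ 1) w
AWalk-unlift [] _ = []
AWalk-unlift {zero} (U∷ v) pos = ⊥-elim (pos [] _ refl [])
AWalk-unlift {suc a} (U∷ v) pos =
  U∷ AWalk-unlift v λ p q eq wp → pos (U ∷ p) q (cong (U ∷_) eq) (U∷ wp)
AWalk-unlift (D∷_ {k} {zero} 1≤k v) pos = ⊥-elim (pos (D k ∷ []) _ refl (D∷_ 1≤k []))
AWalk-unlift {b = b} {w = D k ∷ w} (D∷_ {h = suc h} 1≤k v) pos =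
  subst (λ a → AWalk a (b ∸ 1) (D k ∷ w)) (sym (cong (_∸ 1) (+-suc k h)))
    (D∷_ 1≤k (AWalk-unlift v λ p q eq wp → pos (D k ∷ p) q (cong (D k ∷_) eq) (D∷_ 1≤k wp)))

PositiveBeforeEnd : ℕ → List AStep → Set
PositiveBeforeEnd h w = ∀ p q → w ≡ p ++ q → q ≢ [] → ¬ AWalk h 0 p

PositiveBeforeEnd-U∷ : ∀ {h w} → PositiveBeforeEnd (suc h) w →
  ∀ p q → U ∷ w ≡ p ++ q → p ≢ [] → q ≢ [] → ¬ AWalk h 0 p
PositiveBeforeEnd-U∷ pos []        q _  p≢[] _    _        = p≢[] refl
PositiveBeforeEnd-U∷ pos (U ∷ p)   q eq _    q≢[] (U∷ wp) = pos p q (∷-injectiveʳ eq) q≢[] wp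
PositiveBeforeEnd-U∷ pos (D _ ∷ p) q ()

PositiveBeforeEnd-D∷ : ∀ {k h w} → 1 ≤ k →
  PositiveBeforeEnd h w → PositiveBeforeEnd (k + h) (D k ∷ w)
PositiveBeforeEnd-D∷ (s≤s _) pos []        q _  _ ()
PositiveBeforeEnd-D∷ _       pos (U ∷ p)   q ()
PositiveBeforeEnd-D∷ _       pos (D _ ∷ p) q eq q≢[] wp with refl , eq' ← ∷-injective eq =
  pos p q eq' q≢[] (AWalk-D-tail wp)

Arch : List AStep → Set
Arch γ = AWalk 0 0 γ × γ ≢ [] × (∀ p q → γ ≡ p ++ q → p ≢ [] → q ≢ [] → ¬ AWalk 0 0 p)

lastArch : ∀ {h w} → AWalk h 0 w →
  PositiveBeforeEnd h w ⊎ ∃[ β ] ∃[ γ ] (w ≡ β ++ γ × AWalk h 0 β × Arch γ)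
lastArch [] = inj₁ λ where
  []      q refl q≢[] _ → q≢[] refl
  (_ ∷ _) q ()
lastArch {zero} (U∷ v) with lastArch v
... | inj₂ (β , γ , refl , wβ , arch) = inj₂ (U ∷ β , γ , refl , U∷ wβ , arch)
... | inj₁ pos = inj₂ ([] , _ , refl , [] , U∷ v , (λ ()) , PositiveBeforeEnd-U∷ pos)
lastArch {suc _} (U∷ v) with lastArch v
... | inj₂ (β , γ , refl , wβ , arch) = inj₂ (U ∷ β , γ , refl , U∷ wβ , arch)
... | inj₁ pos = inj₁ λ where
  []      q _  _    ()
  (s ∷ p) q eq q≢[] → PositiveBeforeEnd-U∷ pos (s ∷ p) q eq (λ ()) q≢[]
lastArch (D∷_ 1≤k v) with lastArch v
... | inj₂ (β , γ , refl , wβ , arch) = inj₂ (_ ∷ β , γ , refl , D∷_ 1≤k wβ , arch)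
... | inj₁ pos = inj₁ (PositiveBeforeEnd-D∷ 1≤k pos)

-- Prime paths and lowering

EndsWithD≥2 : List AStep → Set
EndsWithD≥2 α = ∃[ β ] ∃[ k ] (α ≡ β ∷ʳ D k × 2 ≤ k)

IsA-∷ʳD : ∀ {α} → IsA α → ∃[ β ] ∃[ j ] (α ≡ β ∷ʳ D j × 1 ≤ j × AWalk 0 j β)
IsA-∷ʳD {α} (w , _ , α≢[]) with reverseView α
... | []          = ⊥-elim (α≢[] refl)
... | β ∶ _ ∶ʳ U   = ⊥-elim (¬AWalk-∷ʳU-ground β w)
... | β ∶ _ ∶ʳ D j with _ , wβ , D∷_ 1≤j [] ← AWalk-split β w =
  β , j , refl , 1≤j , subst (λ c → AWalk 0 c β) (+-identityʳ j) wβ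

lowerLast-∷ʳ : ∀ β s → lowerLast (β ∷ʳ s) ≡ β ∷ʳ lowerStep s
lowerLast-∷ʳ []           s = refl
lowerLast-∷ʳ (b ∷ [])     s = refl
lowerLast-∷ʳ (b ∷ b' ∷ β) s = cong (b ∷_) (lowerLast-∷ʳ (b' ∷ β) s)

primeShape : ∀ {α} → IsPrime α →
  ∃[ β ] ∃[ j ] (α ≡ U ∷ β ∷ʳ D (suc j) × lower α ≡ β ∷ʳ D j × 1 ≤ j)
primeShape ((w , _) , ([]      , _ , refl , _) , _) = ⊥-elim (¬AWalk-ground-D w)
primeShape ((w , _) , (D _ ∷ _ , _ , refl , _) , _) = ⊥-elim (¬AWalk-ground-D w)
primeShape (_ , (U ∷ β , suc j , refl , s≤s 1≤j) , _) = β , j , refl , lowerLast-∷ʳ β _ , 1≤j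

IsPrime-ends : ∀ {γ} → IsPrime γ → EndsWithD≥2 γ
IsPrime-ends (_ , ends , _) = ends

IsPrime≢[] : ∀ {γ} → IsPrime γ → γ ≢ []
IsPrime≢[] ((_ , _ , γ≢[]) , _) = γ≢[]

prime-length : ∀ {α} → IsPrime α → length α ≡ suc (length (lower α))
prime-length p with β , _ , refl , eq , _ ← primeShape p rewrite eq =
  cong suc (trans (length-++ β) (sym (length-++ β)))

lower-≺ : ∀ {γ} → IsPrime γ → lower γ ≺ γ
lower-≺ g = ≤-reflexive (sym (prime-length g))

lower-IsA : ∀ {α} → IsPrime α → IsA (lower α)
lower-IsA p@((w , noDD , _) , _ , inner) with β , j , refl , eq , 1≤j ← primeShape p
  with U∷ w' ← w with _ , wβ , D∷_ _ [] ← AWalk-split β w' rewrite eq =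
  AWalk-++ (AWalk-unlift wβ positive) (D∷_ 1≤j []) , NoDD-∷ʳD β noDD , ++∷≢[] β
  where
  positive : Positive 1 β
  positive p q refl wp = inner (U ∷ p) (q ∷ʳ D (suc j)) (cong (U ∷_) (++-assoc p q _))
                           (λ ()) (++∷≢[] q) (U∷ wp)

lower-injective : ∀ {α α'} → IsPrime α → IsPrime α' → lower α ≡ lower α' → α ≡ α'
lower-injective p p' eq
  with β , _ , refl , e , _ ← primeShape p | β' , _ , refl , e' , _ ← primeShape p'
  with refl , refl ← ∷ʳ-injective β β' (trans (sym e) (trans eq e')) = refl

lower-surjective : ∀ {α} → IsA α → ∃[ γ ] (IsPrime γ × lower γ ≡ α)
lower-surjective a@(_ , noDD , _) with β , j , refl , 1≤j , wβ ← IsA-∷ʳD a =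
  U ∷ β ∷ʳ D (suc j) ,
  ((U∷ AWalk-++ (AWalk-lift wβ) (AWalk-D-ground (s≤s z≤n)) ,
    NoDD-∷ʳD β noDD , (λ ())) ,
   (U ∷ β , suc j , refl , s≤s 1≤j) , inner) ,
  lowerLast-∷ʳ β _
  where
  inner : ∀ p q → U ∷ β ∷ʳ D (suc j) ≡ p ++ q → p ≢ [] → q ≢ [] → ¬ AWalk 0 0 p
  inner []      q _  p≢[] _    _        = p≢[] refl
  inner (D _ ∷ p) q ()
  inner (U ∷ p) q eq _    q≢[] (U∷ wp) with r , refl ← ∷ʳ-prefix β p q (∷-injectiveʳ eq) q≢[] =
    ¬lifted-reaches-ground p wβ wp

-- The four forms of a path in 𝒜

IsA-UD : IsA (U ∷ D 1 ∷ [])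
IsA-UD = U∷ AWalk-D-ground (s≤s z≤n) , tt , λ ()

IsA-++UD : ∀ {β} → IsA β → IsA (β ++ U ∷ D 1 ∷ [])
IsA-++UD {β} (wβ , nβ , _) =
  AWalk-++ wβ (proj₁ IsA-UD) , NoDD-++U β nβ tt , ++∷≢[] β

IsA-++prime : ∀ {β γ} → IsA β → IsPrime γ → IsA (β ++ γ)
IsA-++prime {β} (wβ , nβ , β≢[]) g@((wγ , nγ , _) , _) with _ , _ , refl , _ ← primeShape g =
  AWalk-++ wβ wγ , NoDD-++U β nβ nγ , λ eq → β≢[] (++-conicalˡ β _ eq)

EndsWithD1 : List AStep → Set
EndsWithD1 α = ∃[ β ] (α ≡ β ∷ʳ D 1)

EndsWithD1-βUD : ∀ β → EndsWithD1 (β ++ U ∷ D 1 ∷ [])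
EndsWithD1-βUD β = β ∷ʳ U , sym (++-assoc β (U ∷ []) (D 1 ∷ []))

EndsWithD≥2-++ : ∀ β {γ} → EndsWithD≥2 γ → EndsWithD≥2 (β ++ γ)
EndsWithD≥2-++ β (γ' , k , refl , 2≤k) = β ++ γ' , k , sym (++-assoc β γ' _) , 2≤k

D1≢D≥2 : ∀ {α α'} → EndsWithD1 α → EndsWithD≥2 α' → α ≢ α'
D1≢D≥2 (β , refl) (β' , k , refl , s≤s (s≤s _)) eq with () ← proj₂ (∷ʳ-injective β β' eq)

UD≢βUD : ∀ {β} → IsA β → U ∷ D 1 ∷ [] ≢ β ++ U ∷ D 1 ∷ []
UD≢βUD {β} (_ , _ , β≢[]) eq = β≢[] (sym (++-cancelʳ (U ∷ D 1 ∷ []) [] β eq))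

prime-indecomposable : ∀ {α β γ} → IsPrime α → α ≡ β ++ γ → AWalk 0 0 β → β ≢ [] → γ ≢ [] → ⊥
prime-indecomposable {β = β} (_ , _ , inner) eq wβ β≢[] γ≢[] = inner β _ eq β≢[] γ≢[] wβ

βγ-unique : ∀ {β β' γ γ'} → IsA β → IsA β' → IsPrime γ → IsPrime γ' →
  β ++ γ ≡ β' ++ γ' → β ≡ β' × γ ≡ γ'
βγ-unique {β} {β'} {γ} {γ'} a a' g g' eq with ++-split β γ β' γ' eq
... | inj₁ ([] , e , e') = sym (trans e (++-identityʳ β)) , e'
... | inj₁ (d@(_ ∷ _) , refl , e') =
  ⊥-elim (prime-indecomposable g e' (AWalk-ground-suffix β (proj₁ a) (proj₁ a'))
                                     (λ ()) (IsPrime≢[] g'))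
... | inj₂ ([] , e , e') = trans e (++-identityʳ β') , sym e'
... | inj₂ (d@(_ ∷ _) , refl , e') =
  ⊥-elim (prime-indecomposable g' e' (AWalk-ground-suffix β' (proj₁ a') (proj₁ a))
                                      (λ ()) (IsPrime≢[] g))

data Form : List AStep → Set where
  UD  : Form (U ∷ D 1 ∷ [])
  βUD : ∀ {β} → IsA β → Form (β ++ U ∷ D 1 ∷ [])
  P   : ∀ {α} → IsPrime α → Form α
  βγ  : ∀ {β γ} → IsA β → IsPrime γ → Form (β ++ γ)

form-D1 : ∀ {β} → NoDD (β ∷ʳ D 1) → AWalk 0 1 β → Form (β ∷ʳ D 1)
form-D1 {β} noDD wβ with reverseView β
... | [] with () ← wβ
... | β' ∶ _ ∶ʳ D _ = ⊥-elim (NoDD-suffix β' (subst NoDD (++-assoc β' _ _) noDD))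
... | [] ∶ _ ∶ʳ U = UD
... | β'@(_ ∷ _) ∶ _ ∶ʳ U with _ , wβ' , U∷ [] ← AWalk-split β' wβ =
  subst Form (sym (++-assoc β' _ _))
    (βUD (wβ' , NoDD-prefix β' (subst NoDD (++-assoc β' _ _) noDD) , λ ()))

form-D≥2 : ∀ {α} → IsA α → EndsWithD≥2 α → Form α
form-D≥2 a@(w , noDD , α≢[]) high with lastArch w
... | inj₁ pos = ⊥-elim (pos [] _ refl α≢[] [])
... | inj₂ ([] , γ , refl , _ , _ , _ , inner) = P (a , high , inner)
... | inj₂ (β@(_ ∷ _) , γ , refl , wβ , wγ , γ≢[] , inner) =
  βγ (wβ , NoDD-prefix β noDD , λ ()) ((wγ , NoDD-suffix β noDD , γ≢[]) , γ-high , inner)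
  where
  γ-high : EndsWithD≥2 γ
  γ-high = let y , k , eq , 2≤k = high ; γ' , eq' = ∷ʳ-suffix β γ y eq γ≢[] in γ' , k , eq' , 2≤k

form : ∀ {α} → IsA α → Form α
form a@(_ , noDD , _) with IsA-∷ʳD a
... | _ , zero          , _    , () , _
... | _ , suc zero      , refl , _  , wβ = form-D1 noDD wβ
... | β , suc (suc _)   , refl , _  , _  = form-D≥2 a (β , _ , refl , s≤s (s≤s z≤n))

-- Peakless Motzkin paths

MWalk-++ : ∀ {a b c x y} → MWalk a b x → MWalk b c y → MWalk a c (x ++ y)
MWalk-++ []      w = w
MWalk-++ (up∷ v) w = up∷ MWalk-++ v w
MWalk-++ (dn∷ v) w = dn∷ MWalk-++ v w
MWalk-++ (fl∷ v) w = fl∷ MWalk-++ v w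

MWalk-split : ∀ {a c} x {y} → MWalk a c (x ++ y) → ∃[ b ] (MWalk a b x × MWalk b c y)
MWalk-split []       w       = _ , [] , w
MWalk-split (up ∷ x) (up∷ w) with b , v , v' ← MWalk-split x w = b , up∷ v , v'
MWalk-split (dn ∷ x) (dn∷ w) with b , v , v' ← MWalk-split x w = b , dn∷ v , v'
MWalk-split (fl ∷ x) (fl∷ w) with b , v , v' ← MWalk-split x w = b , fl∷ v , v'

MWalk-lift : ∀ {a b w} → MWalk a b w → MWalk (suc a) (suc b) w
MWalk-lift []      = []
MWalk-lift (up∷ v) = up∷ MWalk-lift v
MWalk-lift (dn∷ v) = dn∷ MWalk-lift v
MWalk-lift (fl∷ v) = fl∷ MWalk-lift v

MWalk-start-unique : ∀ {a a' b w} → MWalk a b w → MWalk a' b w → a ≡ a'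
MWalk-start-unique []      []       = refl
MWalk-start-unique (up∷ v) (up∷ v') = suc-injective (MWalk-start-unique v v')
MWalk-start-unique (dn∷ v) (dn∷ v') = cong suc (MWalk-start-unique v v')
MWalk-start-unique (fl∷ v) (fl∷ v') = MWalk-start-unique v v'

NoPeak-tail : ∀ s w → NoPeak (s ∷ w) → NoPeak w
NoPeak-tail up []        n = tt
NoPeak-tail up (up ∷ w)  n = n
NoPeak-tail up (dn ∷ w)  ()
NoPeak-tail up (fl ∷ w)  n = n
NoPeak-tail dn w         n = n
NoPeak-tail fl w         n = n

NoPeak-suffix : ∀ x {y} → NoPeak (x ++ y) → NoPeak y
NoPeak-suffix []      n = n
NoPeak-suffix (s ∷ x) n = NoPeak-suffix x (NoPeak-tail s (x ++ _) n)

NoPeak-prefix : ∀ x {y} → NoPeak (x ++ y) → NoPeak x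
NoPeak-prefix []            n = tt
NoPeak-prefix (up ∷ [])     n = tt
NoPeak-prefix (up ∷ up ∷ x) n = NoPeak-prefix (up ∷ x) n
NoPeak-prefix (up ∷ dn ∷ x) ()
NoPeak-prefix (up ∷ fl ∷ x) n = NoPeak-prefix (fl ∷ x) n
NoPeak-prefix (dn ∷ x)      n = NoPeak-prefix x n
NoPeak-prefix (fl ∷ x)      n = NoPeak-prefix x n

-- x ends on the axis, so it does not end with an up step.
NoPeak-++ : ∀ {a x y} → MWalk a 0 x → NoPeak x → NoPeak y → NoPeak (x ++ y)
NoPeak-++ []               nx ny = ny
NoPeak-++ (up∷ (up∷ v))    nx ny = NoPeak-++ (up∷ v) nx ny
NoPeak-++ (up∷ (fl∷ v))    nx ny = NoPeak-++ (fl∷ v) nx ny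
NoPeak-++ (up∷ (dn∷ v))    () ny
NoPeak-++ (dn∷ v)          nx ny = NoPeak-++ v nx ny
NoPeak-++ (fl∷ v)          nx ny = NoPeak-++ v nx ny

NoPeak-up∷ : ∀ {b m y} → MWalk 0 b m → m ≢ [] → NoPeak (m ++ y) → NoPeak (up ∷ m ++ y)
NoPeak-up∷ []      m≢[] _ = ⊥-elim (m≢[] refl)
NoPeak-up∷ (up∷ _) _    n = n
NoPeak-up∷ (fl∷ _) _    n = n

IsM-++ : ∀ {x y} → IsM x → IsM y → IsM (x ++ y)
IsM-++ {x} {y} (wx , nx , x≢[]) (wy , ny , _) =
  MWalk-++ wx wy , NoPeak-++ wx nx ny , λ eq → x≢[] (++-conicalˡ x y eq)

IsM-mountain : ∀ {m} → IsM m → IsM (up ∷ m ++ dn ∷ [])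
IsM-mountain (wm , nm , m≢[]) =
  up∷ MWalk-++ (MWalk-lift wm) (dn∷ []) , NoPeak-up∷ wm m≢[] (NoPeak-++ wm nm tt) , λ ()

IsM-fl : IsM (fl ∷ [])
IsM-fl = fl∷ [] , tt , λ ()

-- ν = x U m, where U is the last step from height k to k + 1 and m is measured from height k + 1.
LastUp : ℕ → ℕ → List MStep → Set
LastUp k d ν = ∃[ x ] ∃[ m ] (ν ≡ x ++ up ∷ m × MWalk 0 k x × MWalk 0 d m)

LastUp-∷ʳ : ∀ {k a b ν s} → MWalk a b (s ∷ []) → LastUp k a ν → LastUp k b (ν ∷ʳ s)
LastUp-∷ʳ ws (x , m , refl , wx , wm) = x , m ∷ʳ _ , ++-assoc x (up ∷ m) _ , wx , MWalk-++ wm ws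

lastUp : ∀ {k} d {ν} → Reverse ν → MWalk 0 (d + suc k) ν → LastUp k d ν
lastUp zero    [] ()
lastUp (suc d) [] ()
lastUp d (ν ∶ r ∶ʳ s) w with MWalk-split ν w
lastUp zero    (ν ∶ r ∶ʳ up) w | _ , wν , up∷ [] = ν , [] , refl , wν , []
lastUp (suc d) (ν ∶ r ∶ʳ up) w | _ , wν , up∷ [] = LastUp-∷ʳ (up∷ []) (lastUp d r wν)
lastUp d       (ν ∶ r ∶ʳ dn) w | _ , wν , dn∷ [] = LastUp-∷ʳ (dn∷ []) (lastUp (suc d) r wν)
lastUp d       (ν ∶ r ∶ʳ fl) w | _ , wν , fl∷ [] = LastUp-∷ʳ (fl∷ []) (lastUp d r wν)

¬MWalk-++up-ground : ∀ y {a b m} → MWalk a b (y ++ up ∷ m) → ¬ MWalk 0 b m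
¬MWalk-++up-ground y w wm with _ , _ , up∷ wm' ← MWalk-split y w
  with () ← MWalk-start-unique wm' wm

up-decomposition-unique : ∀ x y {m m'} → x ++ up ∷ m ≡ y ++ up ∷ m' →
  MWalk 0 0 m → MWalk 0 0 m' → x ≡ y × m ≡ m'
up-decomposition-unique []      []      refl _  _   = refl , refl
up-decomposition-unique []      (_ ∷ y) eq   wm wm' with refl , refl ← ∷-injective eq =
  ⊥-elim (¬MWalk-++up-ground y wm wm')
up-decomposition-unique (_ ∷ x) []      eq   wm wm' with refl , refl ← ∷-injective eq =
  ⊥-elim (¬MWalk-++up-ground x wm' wm)
up-decomposition-unique (_ ∷ x) (_ ∷ y) eq   wm wm' with refl , eq' ← ∷-injective eq
  with refl , refl ← up-decomposition-unique x y eq' wm wm' = refl , refl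

fl≢mountain : ∀ x y {m} → x ∷ʳ fl ≢ y ++ up ∷ m ++ dn ∷ []
fl≢mountain x y eq with () ← proj₂ (∷ʳ-injective x (y ++ up ∷ _) (trans eq (sym (++-assoc y _ _))))

mountain-unique : ∀ x y {m m'} → x ++ up ∷ m ++ dn ∷ [] ≡ y ++ up ∷ m' ++ dn ∷ [] →
  MWalk 0 0 m → MWalk 0 0 m' → x ≡ y × m ≡ m'
mountain-unique x y {m} {m'} eq = up-decomposition-unique x y
  (∷ʳ-injectiveˡ (x ++ up ∷ m) (y ++ up ∷ m')
    (trans (++-assoc x _ _) (trans eq (sym (++-assoc y _ _)))))

data MForm : List MStep → Set where
  F     : MForm (fl ∷ [])
  mF    : ∀ {m} → IsM m → MForm (m ++ fl ∷ [])
  UmD   : ∀ {m} → IsM m → MForm (up ∷ m ++ dn ∷ [])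
  m'UmD : ∀ {m' m} → IsM m' → IsM m → MForm (m' ++ up ∷ m ++ dn ∷ [])

mform-UmD : ∀ x {m} → NoPeak (x ++ up ∷ m ++ dn ∷ []) → MWalk 0 0 x → MWalk 0 0 m →
  MForm (x ++ up ∷ m ++ dn ∷ [])
mform-UmD x {[]} n _ _ = ⊥-elim (NoPeak-suffix x n)
mform-UmD []          {m@(_ ∷ _)} n _  wm =
  UmD (wm , NoPeak-prefix m (NoPeak-tail up (m ++ _) n) , λ ())
mform-UmD x@(_ ∷ _) {m@(_ ∷ _)} n wx wm =
  m'UmD (wx , NoPeak-prefix x n , λ ())
        (wm , NoPeak-prefix m (NoPeak-tail up (m ++ _) (NoPeak-suffix x n)) , λ ())

mform : ∀ {μ} → IsM μ → MForm μ
mform {μ} (w , n , μ≢[]) with reverseView μ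
... | [] = ⊥-elim (μ≢[] refl)
... | ν ∶ _ ∶ʳ up with _ , _ , up∷ () ← MWalk-split ν w
... | [] ∶ _ ∶ʳ fl = F
... | ν@(_ ∷ _) ∶ _ ∶ʳ fl with _ , wν , fl∷ [] ← MWalk-split ν w =
  mF (wν , NoPeak-prefix ν n , λ ())
... | ν ∶ r ∶ʳ dn with _ , wν , dn∷ [] ← MWalk-split ν w
  with x , m , refl , wx , wm ← lastUp 0 r wν =
  subst MForm (sym eq) (mform-UmD x (subst NoPeak eq n) wx wm)
  where
  eq : (x ++ up ∷ m) ∷ʳ dn ≡ x ++ up ∷ m ++ dn ∷ []
  eq = ++-assoc x (up ∷ m) (dn ∷ [])

-- The map ψ

Ψ-IsM : ∀ {α μ} → Ψ α μ → IsM μ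
Ψ-IsM ψ-UD            = IsM-fl
Ψ-IsM (ψ-βUD _ d)     = IsM-mountain (Ψ-IsM d)
Ψ-IsM (ψ-P _ d)       = IsM-++ (Ψ-IsM d) IsM-fl
Ψ-IsM (ψ-βγ _ _ d d') = IsM-++ (Ψ-IsM d') (IsM-mountain (Ψ-IsM d))

Ψ-nonempty : ∀ {α μ} → Ψ α μ → μ ≢ []
Ψ-nonempty d = proj₂ (proj₂ (Ψ-IsM d))

Ψ-walk : ∀ {α μ} → Ψ α μ → MWalk 0 0 μ
Ψ-walk d = proj₁ (Ψ-IsM d)

Ψ-length : ∀ {α μ} → Ψ α μ → length α ≡ suc (length μ)
Ψ-length ψ-UD = refl
Ψ-length (ψ-βUD {β} {m} _ d)
  rewrite length-++ β {U ∷ D 1 ∷ []} | length-++ m {dn ∷ []} | Ψ-length d =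
  cong suc (+-suc (length m) 1)
Ψ-length (ψ-P {m = m} p d)
  rewrite prime-length p | Ψ-length d | length-++ m {fl ∷ []} =
  cong suc (+-comm 1 (length m))
Ψ-length (ψ-βγ {β} {γ} {m} {m'} _ g d d')
  rewrite length-++ β {γ} | prime-length g | Ψ-length d | Ψ-length d'
        | length-++ m' {up ∷ m ++ dn ∷ []} | length-++ m {dn ∷ []} =
  arithmetic (length m) (length m')
  where
  arithmetic : ∀ a b → suc a + suc (suc b) ≡ suc (b + suc (a + 1))
  arithmetic = solve-∀

Ψ-functional : ∀ {α α' μ μ'} → Ψ α μ → Ψ α' μ' → α ≡ α' → μ ≡ μ'
Ψ-functional ψ-UD ψ-UD _ = refl
Ψ-functional ψ-UD (ψ-βUD a _) eq = ⊥-elim (UD≢βUD a eq)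
Ψ-functional ψ-UD (ψ-P g _) eq = ⊥-elim (D1≢D≥2 (U ∷ [] , refl) (IsPrime-ends g) eq)
Ψ-functional ψ-UD (ψ-βγ {β} _ g _ _) eq =
  ⊥-elim (D1≢D≥2 (U ∷ [] , refl) (EndsWithD≥2-++ β (IsPrime-ends g)) eq)
Ψ-functional (ψ-βUD a _) ψ-UD eq = ⊥-elim (UD≢βUD a (sym eq))
Ψ-functional (ψ-βUD {β} a d) (ψ-βUD {β'} a' d') eq
  with refl ← ++-cancelʳ (U ∷ D 1 ∷ []) β β' eq =
  cong (λ m → up ∷ m ++ dn ∷ []) (Ψ-functional d d' refl)
Ψ-functional (ψ-βUD {β} _ _) (ψ-P g _) eq = ⊥-elim (D1≢D≥2 (EndsWithD1-βUD β) (IsPrime-ends g) eq)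
Ψ-functional (ψ-βUD {β} _ _) (ψ-βγ {β'} _ g _ _) eq =
  ⊥-elim (D1≢D≥2 (EndsWithD1-βUD β) (EndsWithD≥2-++ β' (IsPrime-ends g)) eq)
Ψ-functional (ψ-P g _) ψ-UD eq = ⊥-elim (D1≢D≥2 (U ∷ [] , refl) (IsPrime-ends g) (sym eq))
Ψ-functional (ψ-P g _) (ψ-βUD {β} _ _) eq =
  ⊥-elim (D1≢D≥2 (EndsWithD1-βUD β) (IsPrime-ends g) (sym eq))
Ψ-functional (ψ-P g d) (ψ-P _ d') refl = cong (_++ fl ∷ []) (Ψ-functional d d' refl)
Ψ-functional (ψ-P g _) (ψ-βγ (wβ , _ , β≢[]) g' _ _) eq =
  ⊥-elim (prime-indecomposable g eq wβ β≢[] (IsPrime≢[] g'))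
Ψ-functional (ψ-βγ {β} _ g _ _) ψ-UD eq =
  ⊥-elim (D1≢D≥2 (U ∷ [] , refl) (EndsWithD≥2-++ β (IsPrime-ends g)) (sym eq))
Ψ-functional (ψ-βγ {β} _ g _ _) (ψ-βUD {β'} _ _) eq =
  ⊥-elim (D1≢D≥2 (EndsWithD1-βUD β') (EndsWithD≥2-++ β (IsPrime-ends g)) (sym eq))
Ψ-functional (ψ-βγ (wβ , _ , β≢[]) g _ _) (ψ-P g' _) eq =
  ⊥-elim (prime-indecomposable g' (sym eq) wβ β≢[] (IsPrime≢[] g))
Ψ-functional (ψ-βγ a g d₁ d₂) (ψ-βγ a' g' d₁' d₂') eq with refl , refl ← βγ-unique a a' g g' eq =
  cong₂ (λ m m' → m' ++ up ∷ m ++ dn ∷ []) (Ψ-functional d₁ d₁' refl) (Ψ-functional d₂ d₂' refl)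

Ψ-injective : ∀ {α α' μ μ'} → Ψ α μ → Ψ α' μ' → μ ≡ μ' → α ≡ α'
Ψ-injective ψ-UD ψ-UD _ = refl
Ψ-injective ψ-UD (ψ-βUD _ _) eq = ⊥-elim (fl≢mountain [] [] eq)
Ψ-injective ψ-UD (ψ-P {m = m} _ d) eq = ⊥-elim (Ψ-nonempty d (sym (∷ʳ-injectiveˡ [] m eq)))
Ψ-injective ψ-UD (ψ-βγ {m' = m'} _ _ _ _) eq = ⊥-elim (fl≢mountain [] m' eq)
Ψ-injective (ψ-βUD _ _) ψ-UD eq = ⊥-elim (fl≢mountain [] [] (sym eq))
Ψ-injective (ψ-βUD _ d) (ψ-βUD _ d') eq
  with _ , e ← mountain-unique [] [] eq (Ψ-walk d) (Ψ-walk d') with refl ← Ψ-injective d d' e = refl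
Ψ-injective (ψ-βUD _ _) (ψ-P {m = m} _ _) eq = ⊥-elim (fl≢mountain m [] (sym eq))
Ψ-injective (ψ-βUD _ d) (ψ-βγ _ _ d₁ d₂) eq
  with e , _ ← mountain-unique [] _ eq (Ψ-walk d) (Ψ-walk d₁) = ⊥-elim (Ψ-nonempty d₂ (sym e))
Ψ-injective (ψ-P {m = m} _ d) ψ-UD eq = ⊥-elim (Ψ-nonempty d (∷ʳ-injectiveˡ m [] eq))
Ψ-injective (ψ-P {m = m} _ _) (ψ-βUD _ _) eq = ⊥-elim (fl≢mountain m [] eq)
Ψ-injective (ψ-P {m = m} g d) (ψ-P {m = m'} g' d') eq =
  lower-injective g g' (Ψ-injective d d' (∷ʳ-injectiveˡ m m' eq))
Ψ-injective (ψ-P {m = m} _ _) (ψ-βγ {m' = m'} _ _ _ _) eq = ⊥-elim (fl≢mountain m m' eq)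
Ψ-injective (ψ-βγ {m' = m'} _ _ _ _) ψ-UD eq = ⊥-elim (fl≢mountain [] m' (sym eq))
Ψ-injective (ψ-βγ _ _ d₁ d₂) (ψ-βUD _ d) eq
  with e , _ ← mountain-unique _ [] eq (Ψ-walk d₁) (Ψ-walk d) = ⊥-elim (Ψ-nonempty d₂ e)
Ψ-injective (ψ-βγ {m' = m'} _ _ _ _) (ψ-P {m = m} _ _) eq = ⊥-elim (fl≢mountain m m' (sym eq))
Ψ-injective (ψ-βγ _ g d₁ d₂) (ψ-βγ _ g' d₁' d₂') eq
  with e₂ , e₁ ← mountain-unique _ _ eq (Ψ-walk d₁) (Ψ-walk d₁')
  with refl ← Ψ-injective d₁ d₁' e₁ | refl ← lower-injective g g' (Ψ-injective d₂ d₂' e₂) = refl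

Ψ-total : ∀ {α} → Acc _≺_ α → IsA α → ∃[ μ ] Ψ α μ
Ψ-total (acc rec) a with form a
... | UD = _ , ψ-UD
... | βUD {β} b = let _ , d = Ψ-total (rec (xs≺xs++ys β λ ())) b in _ , ψ-βUD b d
... | P g = let _ , d = Ψ-total (rec (lower-≺ g)) (lower-IsA g) in _ , ψ-P g d
... | βγ {β} {γ} b g =
  let _ , d₁ = Ψ-total (rec (xs≺xs++ys β (IsPrime≢[] g))) b
      _ , d₂ = Ψ-total (rec (xs≺ys⇒xs≺zs++ys β {lower γ} (lower-≺ g))) (lower-IsA g)
  in _ , ψ-βγ b g d₁ d₂

Ψ-surjective : ∀ {μ} → Acc _≺_ μ → IsM μ → ∃[ α ] (IsA α × Ψ α μ)
Ψ-surjective (acc rec) i with mform i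
... | F = _ , IsA-UD , ψ-UD
... | mF {m} i
  with α , a , d ← Ψ-surjective (rec (xs≺xs++ys m λ ())) i
  with γ , g , refl ← lower-surjective a = γ , proj₁ g , ψ-P g d
... | UmD {m} i
  with α , a , d ← Ψ-surjective (rec (xs≺x∷xs++ys up m (dn ∷ []))) i = _ , IsA-++UD a , ψ-βUD a d
... | m'UmD {m'} {m} i' i
  with α , a , d ← Ψ-surjective (rec (xs≺ys⇒xs≺zs++ys m' {m} (xs≺x∷xs++ys up m (dn ∷ [])))) i
  with α' , a' , d' ← Ψ-surjective (rec (xs≺xs++ys m' λ ())) i'
  with γ , g , refl ← lower-surjective a' = _ , IsA-++prime a g , ψ-βγ a g d d'

theorem1 : ∀ (n : ℕ) → 2 ≤ n →
    (∀ (α : List AStep) → InA n α → ∃[ μ ] (Ψ α μ × InM (n ∸ 1) μ))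
    × (∀ (α : List AStep) (μ μ' : List MStep) → InA n α → Ψ α μ → Ψ α μ' → μ ≡ μ')
    × (∀ (α α' : List AStep) (μ : List MStep) → InA n α → InA n α' → Ψ α μ → Ψ α' μ → α ≡ α')
    × (∀ (μ : List MStep) → InM (n ∸ 1) μ → ∃[ α ] (InA n α × Ψ α μ))
-- The bound n ≥ 2 only excludes n = 0, where n ∸ 1 truncates to 0; for n = 1 both sides are empty.
theorem1 zero    ()
theorem1 (suc n) _  = total , functional , injective , surjective
  where
  total : ∀ α → InA (suc n) α → ∃[ μ ] (Ψ α μ × InM n μ)
  total α (a , |α|) = let μ , d = Ψ-total (≺-wellFounded α) a in
    μ , d , Ψ-IsM d , suc-injective (trans (sym (Ψ-length d)) |α|)
  functional : ∀ α μ μ' → InA (suc n) α → Ψ α μ → Ψ α μ' → μ ≡ μ'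
  functional _ _ _ _ d d' = Ψ-functional d d' refl
  injective : ∀ α α' μ → InA (suc n) α → InA (suc n) α' → Ψ α μ → Ψ α' μ → α ≡ α'
  injective _ _ _ _ _ d d' = Ψ-injective d d' refl
  surjective : ∀ μ → InM n μ → ∃[ α ] (InA (suc n) α × Ψ α μ)
  surjective μ (i , |μ|) = let α , a , d = Ψ-surjective (≺-wellFounded μ) i in
    α , (a , trans (Ψ-length d) (cong suc |μ|)) , d
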